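{- Let $S$ be a Kleene relation algebra satisfying the Tarski rule and let $\mathsf{Z}, \mathsf{S} \in S$ be such that $\mathsf{Z}$ is a point, $\mathsf{S}$ is an injective mapping, and $(\mathsf{S}^T)^* \cdot \mathsf{Z} = \top$. Let $\mathsf{S'} = \mathsf{S} \sqcap \overline{\mathsf{Z}^T}$. Then $(\mathsf{S'}^T)^* \cdot \mathsf{Z} = \top$.
   Context: A Kleene relation algebra is a structure $(S,\sqcup,\sqcap,\cdot,\overline{\phantom{x}},{}^T,{}^*,\bot,\top,1)$ such that $(S,\sqcup,\sqcap,\overline{\phantom{x}},\bot,\top)$ is a Boolean algebra with order $x \sqsubseteq y \iff x \sqcup y = y$; $(S,\sqcup,\cdot,\bot,1)$ is an idempotent semiring ($\cdot$ associative with two-sided unit $1$, distributing over $\sqcup$, $\bot$ a two-sided zero of $\cdot$); transposition satisfies $(x\sqcup y)^T = x^T \sqcup y^T$, $(x^T)^T = x$, $(x\cdot y)^T = y^T\cdot x^T$ and $(x\cdot y)\sqcap z \sqsubseteq x\cdot(y\sqcap(x^T\cdot z))$; and the star satisfies $1\sqcup y\cdot y^* = y^* = 1 \sqcup y^*\cdot y$, $z\sqcup y\cdot x\sqsubseteq x \Rightarrow y^*\cdot z\sqsubseteq x$, $z \sqcup x\cdot y \sqsubseteq x \Rightarrow z\cdot y^*\sqsubseteq x$. The Tarski rule states $\top\cdot x\cdot\top = \top$ for every $x \neq \bot$. An element $x$ is univalent if $x^T x\sqsubseteq 1$, total if $1\sqsubseteq x x^T$, a mapping if univalent and total, injective if $x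 x^T\sqsubseteq 1$, surjective if $1\sqsubseteq x^T x$, a vector if $x\cdot\top = x$, and a point if it is an injective surjective vector. -}

module Defs where

open import Level using (Level; suc)
open import Relation.Binary.PropositionalEquality using (_≡_)
open import Relation.Nullary using (¬_)
open import Data.Product using (_×_)

record KleeneRelationAlgebra (ℓ : Level) : Set (suc ℓ) where
  infixr 6 _⊔_
  infixr 7 _⊓_
  infixl 8 _·_
  infix 4 _⊑_
  field
    S    : Set ℓ
    _⊔_  : S → S → S
    _⊓_  : S → S → S
    _·_  : S → S → S
    ∁    : S → S
    _ᵀ   : S → S
    _⋆   : S → S
    ⊥    : S
    ⊤    : S
    𝟏    : S

  _⊑_ : S → S → Set ℓ
  x ⊑ y = x ⊔ y ≡ y

  field
    ⊔-assoc     : ∀ x y z → (x ⊔ y) ⊔ z ≡ x ⊔ (y ⊔ z)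
    ⊔-comm      : ∀ x y → x ⊔ y ≡ y ⊔ x
    ⊓-assoc     : ∀ x y z → (x ⊓ y) ⊓ z ≡ x ⊓ (y ⊓ z)
    ⊓-comm      : ∀ x y → x ⊓ y ≡ y ⊓ x
    ⊔-absorb-⊓  : ∀ x y → x ⊔ (x ⊓ y) ≡ x
    ⊓-absorb-⊔  : ∀ x y → x ⊓ (x ⊔ y) ≡ x
    ⊓-distrib-⊔ : ∀ x y z → x ⊓ (y ⊔ z) ≡ (x ⊓ y) ⊔ (x ⊓ z)
    ⊔-distrib-⊓ : ∀ x y z → x ⊔ (y ⊓ z) ≡ (x ⊔ y) ⊓ (x ⊔ z)
    ⊔-bot       : ∀ x → x ⊔ ⊥ ≡ x
    ⊓-top       : ∀ x → x ⊓ ⊤ ≡ x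
    ⊔-compl     : ∀ x → x ⊔ ∁ x ≡ ⊤
    ⊓-compl     : ∀ x → x ⊓ ∁ x ≡ ⊥
    ⊔-idem      : ∀ x → x ⊔ x ≡ x
    ·-assoc     : ∀ x y z → (x · y) · z ≡ x · (y · z)
    ·-identityˡ : ∀ x → 𝟏 · x ≡ x
    ·-identityʳ : ∀ x → x · 𝟏 ≡ x
    ·-distribˡ  : ∀ x y z → x · (y ⊔ z) ≡ (x · y) ⊔ (x · z)
    ·-distribʳ  : ∀ x y z → (y ⊔ z) · x ≡ (y · x) ⊔ (z · x)
    ·-zeroˡ     : ∀ x → ⊥ · x ≡ ⊥
    ·-zeroʳ     : ∀ x → x · ⊥ ≡ ⊥
    ᵀ-⊔         : ∀ x y → (x ⊔ y) ᵀ ≡ (x ᵀ) ⊔ (y ᵀ)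
    ᵀ-invol     : ∀ x → (x ᵀ) ᵀ ≡ x
    ᵀ-·         : ∀ x y → (x · y) ᵀ ≡ (y ᵀ) · (x ᵀ)
    dedekind    : ∀ x y z → (x · y) ⊓ z ⊑ x · (y ⊓ ((x ᵀ) · z))
    star-unfoldˡ : ∀ y → 𝟏 ⊔ y · (y ⋆) ≡ y ⋆
    star-unfoldʳ : ∀ y → 𝟏 ⊔ (y ⋆) · y ≡ y ⋆
    star-inductˡ : ∀ x y z → z ⊔ y · x ⊑ x → (y ⋆) · z ⊑ x
    star-inductʳ : ∀ x y z → z ⊔ x · y ⊑ x → z · (y ⋆) ⊑ x

  TarskiRule : Set ℓ
  TarskiRule = ∀ x → ¬ (x ≡ ⊥) → ⊤ · x · ⊤ ≡ ⊤

  univalent injective total surjective mapping vector point : S → Set ℓ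
  univalent x  = (x ᵀ) · x ⊑ 𝟏
  total x      = 𝟏 ⊑ x · (x ᵀ)
  injective x  = x · (x ᵀ) ⊑ 𝟏
  surjective x = 𝟏 ⊑ (x ᵀ) · x
  mapping x    = univalent x × total x
  vector x     = x · ⊤ ≡ x
  point x      = injective x × surjective x × vector x

{-# OPTIONS --safe #-}
-- Split Sᵀ as S'ᵀ ⊔ (S ⊓ Zᵀ)ᵀ. The second summand lies below Z, and a vector absorbs
-- anything multiplied on its right, so it sends S'ᵀ⋆·Z back into Z ⊑ S'ᵀ⋆·Z. Hence
-- S'ᵀ⋆·Z is closed under Sᵀ and contains Z, and star induction gives ⊤ = Sᵀ⋆·Z ⊑ S'ᵀ⋆·Z.
module Submission where

open import Defs
open import Level using (Level)
open import Relation.Binary.PropositionalEquality using (_≡_; sym; trans; cong; cong₂)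
open import Data.Product using (_,_)

module KleeneRelationAlgebraProperties {ℓ : Level} (K : KleeneRelationAlgebra ℓ) where
  open KleeneRelationAlgebra K

  ⊑-trans : ∀ {x y z} → x ⊑ y → y ⊑ z → x ⊑ z
  ⊑-trans {x} {y} {z} x⊑y y⊑z =
    trans (cong (x ⊔_) (sym y⊑z)) (trans (sym (⊔-assoc x y z)) (trans (cong (_⊔ z) x⊑y) y⊑z))

  ⊑-antisym : ∀ {x y} → x ⊑ y → y ⊑ x → x ≡ y
  ⊑-antisym {x} {y} x⊑y y⊑x = trans (sym y⊑x) (trans (⊔-comm y x) x⊑y)

  ⊔-lub : ∀ {x y z} → x ⊑ z → y ⊑ z → x ⊔ y ⊑ z
  ⊔-lub {x} {y} {z} x⊑z y⊑z = trans (⊔-assoc x y z) (trans (cong (x ⊔_) y⊑z) x⊑z)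

  ⊔-upperˡ : ∀ x y → x ⊑ x ⊔ y
  ⊔-upperˡ x y = trans (sym (⊔-assoc x x y)) (cong (_⊔ y) (⊔-idem x))

  ⊔-upperʳ : ∀ x y → y ⊑ x ⊔ y
  ⊔-upperʳ x y = trans (cong (y ⊔_) (⊔-comm x y)) (trans (⊔-upperˡ y x) (⊔-comm y x))

  ≡⇒⊑ : ∀ {x y} → x ≡ y → x ⊑ y
  ≡⇒⊑ {x} x≡y = trans (cong (x ⊔_) (sym x≡y)) (trans (⊔-idem x) x≡y)

  ⊑-⊤ : ∀ x → x ⊑ ⊤
  ⊑-⊤ x = trans (cong (x ⊔_) (sym (⊔-compl x)))
            (trans (sym (⊔-assoc x x (∁ x))) (trans (cong (_⊔ ∁ x) (⊔-idem x)) (⊔-compl x)))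

  ⊓-lowerʳ : ∀ x y → x ⊓ y ⊑ y
  ⊓-lowerʳ x y = trans (⊔-comm (x ⊓ y) y) (trans (cong (y ⊔_) (⊓-comm x y)) (⊔-absorb-⊓ y x))

  ⊓-∁-partition : ∀ x y → x ≡ (x ⊓ ∁ y) ⊔ (x ⊓ y)
  ⊓-∁-partition x y = trans (sym (⊓-top x))
    (trans (cong (x ⊓_) (trans (sym (⊔-compl y)) (⊔-comm y (∁ y)))) (⊓-distrib-⊔ x (∁ y) y))

  ·-monoʳ : ∀ z {x y} → x ⊑ y → z · x ⊑ z · y
  ·-monoʳ z {x} {y} x⊑y = trans (sym (·-distribˡ z x y)) (cong (z ·_) x⊑y)

  ·-monoˡ : ∀ z {x y} → x ⊑ y → x · z ⊑ y · z
  ·-monoˡ z {x} {y} x⊑y = trans (sym (·-distribʳ z x y)) (cong (_· z) x⊑y)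

  ᵀ-mono : ∀ {x y} → x ⊑ y → x ᵀ ⊑ y ᵀ
  ᵀ-mono {x} {y} x⊑y = trans (sym (ᵀ-⊔ x y)) (cong _ᵀ x⊑y)

  ⊑ᵀ⇒ᵀ⊑ : ∀ {x y} → x ⊑ y ᵀ → x ᵀ ⊑ y
  ⊑ᵀ⇒ᵀ⊑ {x} {y} x⊑yᵀ = trans (cong (x ᵀ ⊔_) (sym (ᵀ-invol y))) (trans (ᵀ-mono x⊑yᵀ) (ᵀ-invol y))

  vector-absorbʳ : ∀ {v} → vector v → ∀ x → v · x ⊑ v
  vector-absorbʳ {v} v-vec x = ⊑-trans (·-monoʳ v (⊑-⊤ x)) (≡⇒⊑ v-vec)

  star-·-unfoldˡ : ∀ y z → z ⊔ y · (y ⋆ · z) ≡ y ⋆ · z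
  star-·-unfoldˡ y z = trans (cong₂ _⊔_ (sym (·-identityˡ z)) (sym (·-assoc y (y ⋆) z)))
                             (trans (sym (·-distribʳ z 𝟏 (y · y ⋆))) (cong (_· z) (star-unfoldˡ y)))

  ⊑-star-· : ∀ y z → z ⊑ y ⋆ · z
  ⊑-star-· y z = ⊑-trans (⊔-upperˡ z (y · (y ⋆ · z))) (≡⇒⊑ (star-·-unfoldˡ y z))

  star-·-closedˡ : ∀ y z → y · (y ⋆ · z) ⊑ y ⋆ · z
  star-·-closedˡ y z = ⊑-trans (⊔-upperʳ z (y · (y ⋆ · z))) (≡⇒⊑ (star-·-unfoldˡ y z))

  star-⊔-below-vector : ∀ {v} → vector v → ∀ y {w} → w ⊑ v → (y ⊔ w) ⋆ · v ⊑ y ⋆ · v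
  star-⊔-below-vector {v} v-vec y {w} w⊑v = star-inductˡ (y ⋆ · v) (y ⊔ w) v closed
    where
    w-step : w · (y ⋆ · v) ⊑ y ⋆ · v
    w-step = ⊑-trans (·-monoˡ (y ⋆ · v) w⊑v)
                     (⊑-trans (vector-absorbʳ v-vec (y ⋆ · v)) (⊑-star-· y v))

    closed : v ⊔ (y ⊔ w) · (y ⋆ · v) ⊑ y ⋆ · v
    closed = ⊔-lub (⊑-star-· y v)
               (trans (cong (_⊔ y ⋆ · v) (·-distribʳ (y ⋆ · v) y w))
                      (⊔-lub (star-·-closedˡ y v) w-step))

  ᵀ-star-·-vector-drop : ∀ {v} → vector v → ∀ s →
    (s ᵀ) ⋆ · v ⊑ ((s ⊓ ∁ (v ᵀ)) ᵀ) ⋆ · v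
  ᵀ-star-·-vector-drop {v} v-vec s =
    trans (cong (λ t → (t ⋆ · v) ⊔ rhs) sᵀ-split)
          (star-⊔-below-vector v-vec ((s ⊓ ∁ (v ᵀ)) ᵀ) (⊑ᵀ⇒ᵀ⊑ (⊓-lowerʳ s (v ᵀ))))
    where
    rhs : S
    rhs = ((s ⊓ ∁ (v ᵀ)) ᵀ) ⋆ · v

    sᵀ-split : s ᵀ ≡ ((s ⊓ ∁ (v ᵀ)) ᵀ) ⊔ ((s ⊓ (v ᵀ)) ᵀ)
    sᵀ-split = trans (cong _ᵀ (⊓-∁-partition s (v ᵀ))) (ᵀ-⊔ (s ⊓ ∁ (v ᵀ)) (s ⊓ (v ᵀ)))

theorem7p3 : {ℓ : Level} (K : KleeneRelationAlgebra ℓ) → let open KleeneRelationAlgebra K in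
    TarskiRule → (Z Sc : S) → point Z → mapping Sc → injective Sc → (((Sc ᵀ) ⋆) · Z ≡ ⊤) →
    ((((Sc ⊓ ∁ (Z ᵀ)) ᵀ) ⋆) · Z ≡ ⊤)
theorem7p3 K _ Z Sc (_ , _ , Z-vector) _ _ Scᵀ⋆Z≡⊤ =
  ⊑-antisym (⊑-⊤ _) (trans (cong (_⊔ _) (sym Scᵀ⋆Z≡⊤)) (ᵀ-star-·-vector-drop Z-vector Sc))
  where open KleeneRelationAlgebra K
        open KleeneRelationAlgebraProperties K
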